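{- Let $(h,\ast,1_h)$ be a connected associative presheaf and let $\mathcal I(h)\subseteq\mathcal G(h)$ be the set of irreducible coinvariants. Then the space of primitive elements of the Hopf algebra $\mathcal A(h)$, namely $\{x\in\mathcal A(h):\Delta x=x\otimes\mathbf 1+\mathbf 1\otimes x\}$ where $\mathbf 1$ is the unit of $\mathcal A(h)$, equals $\operatorname{span}\{\mathrm{p}_a: a\in\mathcal I(h)\}$.
   Context: A combinatorial presheaf $h$ is a contravariant functor from finite sets with injections to finite sets; $h[I]$ are objects on $I$, $a|_J$ restriction to $J\subseteq I$. $a\sim b$ if related by a relabeling bijection; $\mathcal G(h)=\biguplus_n h[[n]]/\sim$. For $b\in h[I]$, $\mathrm{p}_a(b)=|\{J'\subseteq I:b|_{J'}\sim a\}|$; $\mathcal A(h)$ is the $\mathbb Q$-span of these functions on $\mathcal G(h)$, with pointwise product. An associative presheaf $(h,\ast,1)$ has natural products $h[I]\times h[J]\to h[I\sqcup J]$ for disjoint $I,J$ with $(a\ast b)|_{A\sqcup B}=a|_A\ast b|_B$, associative, with unit $1\in h[\emptyset]$; it is connected if $|h[\emptyset]|=1$. It induces an associative product $\cdot$ on $\mathcal G(h)$ (class of $a\ast b'$ where $b'$ is a copy of $b$ on a set disjoint from that of $a$). $\mathcal A(h)$ is a Hopf algebra with coproduct $\Delta\mathrm{p}_a=\sum_{b\cdot c=a}\mathrm{p}_b\otimes\mathrm{p}_c$ and unit $\mathbf 1=\mathrm{p}_{1}$ (connected case). A coinvariant $t\ne 1$ is irreducible if $a\cdot b=t$ implies $a=1$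 or $b=1$. -}

module Defs where

open import Data.Nat using (ℕ; zero; suc; _+_)
open import Data.Nat.Properties using (+-assoc; +-identityʳ)
open import Data.Fin using (Fin; zero; suc; _↑ˡ_; _↑ʳ_; _<_)
open import Data.Fin.Properties using (any?; all?; _<?_; suc-injective)
import Data.Fin.Properties as FinP
open import Data.Vec using (Vec; []; _∷_)
open import Data.Vec.Functional using () renaming (_∷_ to _◂_)
open import Data.List using (List; []; _∷_; map; _++_; foldr)
open import Data.Bool using (Bool; true; false)
open import Data.Product using (Σ; ∃; _×_; _,_; proj₁; proj₂)
open import Data.Sum using (_⊎_)
open import Data.Rational using (ℚ; 0ℚ; 1ℚ) renaming (_+_ to _+ℚ_; _*_ to _*ℚ_)
open import Function using (_∘_; id)
open import Function.Bundles using (_↣_; _↔_; Injection; Inverse; mk↣; mk↔ₛ′)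
open import Function.Properties.Inverse using (↔⇒↣)
open import Relation.Binary.PropositionalEquality
  using (_≡_; refl; sym; trans; cong; subst; _≗_)
open import Relation.Nullary using (Dec; yes; no; ¬_; does)
open import Relation.Nullary.Decidable using (map′; _×-dec_; ¬?)

-- Combinatorial presheaves, on the skeleton {[n] : n ∈ ℕ} of the
-- category of finite sets with injections.  h[[n]] is  H n, and for an
-- injection f : [m] ↪ [n],  res f : H n → H m  is h[f].

record Presheaf : Set₁ where
  field
    H     : ℕ → Set
    size  : ℕ → ℕ
    enum  : ∀ n → H n ↔ Fin (size n)
    res   : ∀ {m n} → Fin m ↣ Fin n → H n → H m
    -- functoriality (injections are compared as functions, i.e. pointwise)
    res-id : ∀ {n} (k : Fin n ↣ Fin n) → (∀ i → Injection.to k i ≡ i) →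
             ∀ x → res k x ≡ x
    res-∘  : ∀ {l m n} (f : Fin m ↣ Fin n) (g : Fin l ↣ Fin m) (k : Fin l ↣ Fin n) →
             (∀ i → Injection.to k i ≡ Injection.to f (Injection.to g i)) →
             ∀ x → res k x ≡ res g (res f x)

-- Associative presheaves.  The disjoint union [m] ⊔ [n] is [m + n]
-- ([m] first via _↑ˡ_, then [n] via _↑ʳ_).

record AssocPresheaf : Set₁ where
  field
    presheaf : Presheaf
  open Presheaf presheaf
  field
    _⋆_ : ∀ {m n} → H m → H n → H (m + n)
    -- naturality: (a ⋆ b) restricted along f ⊔ g is (a|f) ⋆ (b|g)
    ⋆-natural : ∀ {m' m n' n} (f : Fin m' ↣ Fin m) (g : Fin n' ↣ Fin n)
                (k : Fin (m' + n') ↣ Fin (m + n)) →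
                (∀ i → Injection.to k (i ↑ˡ n') ≡ Injection.to f i ↑ˡ n) →
                (∀ j → Injection.to k (m' ↑ʳ j) ≡ m ↑ʳ Injection.to g j) →
                ∀ a b → res k (a ⋆ b) ≡ res f a ⋆ res g b
    ⋆-assoc : ∀ {m n l} (a : H m) (b : H n) (c : H l) →
              (a ⋆ b) ⋆ c ≡ subst H (sym (+-assoc m n l)) (a ⋆ (b ⋆ c))
    unit   : H 0
    unitˡ  : ∀ {n} (a : H n) → unit ⋆ a ≡ a
    unitʳ  : ∀ {n} (a : H n) → a ⋆ unit ≡ subst H (sym (+-identityʳ n)) a

Connected : AssocPresheaf → Set
Connected h = ∀ (x : H 0) → x ≡ unit
  where open AssocPresheaf h ; open Presheaf presheaf

exFun? : ∀ m n (P : (Fin m → Fin n) → Set) →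
         (∀ f g → f ≗ g → P f → P g) → (∀ f → Dec (P f)) → Dec (∃ P)
exFun? zero n P resp dec with dec (λ ())
... | yes p = yes ((λ ()) , p)
... | no ¬p = no (λ { (f , pf) → ¬p (resp f (λ ()) (λ ()) pf) })
exFun? (suc m) n P resp dec =
  map′ (λ { (v , g , p) → (v ◂ g) , p })
       (λ { (f , p) → f zero , (f ∘ suc) , resp f (f zero ◂ (f ∘ suc)) eta p })
       (any? (λ v → exFun? m n (λ g → P (v ◂ g))
                     (λ g g' e → resp (v ◂ g) (v ◂ g') (λ { zero → refl ; (suc i) → e i }))
                     (λ g → dec (v ◂ g))))
  where
  eta : ∀ {f : Fin (suc m) → Fin n} → f ≗ (f zero ◂ (f ∘ suc))
  eta zero = refl
  eta (suc i) = refl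

sumFin : ∀ n → (Fin n → ℚ) → ℚ
sumFin zero f = 0ℚ
sumFin (suc n) f = f zero +ℚ sumFin n (f ∘ suc)

sumList : ∀ {A : Set} → List A → (A → ℚ) → ℚ
sumList xs f = foldr (λ x r → f x +ℚ r) 0ℚ xs

indicator : ∀ {P : Set} → Dec P → ℚ
indicator d with does d
... | true = 1ℚ
... | false = 0ℚ

-- subsets of [n] as characteristic vectors, and the order-preserving
-- embedding [|J|] ↪ [n] of a subset J
cnt : ∀ {n} → Vec Bool n → ℕ
cnt [] = 0
cnt (true ∷ J) = suc (cnt J)
cnt (false ∷ J) = cnt J

embF : ∀ {n} (J : Vec Bool n) → Fin (cnt J) → Fin n
embF (true ∷ J) zero = zero
embF (true ∷ J) (suc i) = suc (embF J i)
embF (false ∷ J) i = suc (embF J i)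

embF-inj : ∀ {n} (J : Vec Bool n) {i j} → embF J i ≡ embF J j → i ≡ j
embF-inj (true ∷ J) {zero} {zero} e = refl
embF-inj (true ∷ J) {zero} {suc j} ()
embF-inj (true ∷ J) {suc i} {zero} ()
embF-inj (true ∷ J) {suc i} {suc j} e = cong suc (embF-inj J (suc-injective e))
embF-inj (false ∷ J) e = embF-inj J (suc-injective e)

emb : ∀ {n} (J : Vec Bool n) → Fin (cnt J) ↣ Fin n
emb J = mk↣ (embF-inj J)

allSubsets : ∀ n → List (Vec Bool n)
allSubsets zero = [] ∷ []
allSubsets (suc n) = map (true ∷_) (allSubsets n) ++ map (false ∷_) (allSubsets n)

module _ (h : AssocPresheaf) where
  open AssocPresheaf h
  open Presheaf presheaf

  -- objects of any size; G(h) is this type modulo _∼_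
  Obj : Set
  Obj = Σ ℕ H

  _∼_ : Obj → Obj → Set
  (m , a) ∼ (n , b) = Σ (Fin n ↔ Fin m) λ σ → res (↔⇒↣ σ) a ≡ b

  private
    res-cong : ∀ {m n} (k k' : Fin m ↣ Fin n) → (∀ i → Injection.to k i ≡ Injection.to k' i) →
               ∀ x → res k x ≡ res k' x
    res-cong {n = n} k k' e x =
      trans (res-∘ k' (mk↣ id) k e x) (res-id (mk↣ id) (λ _ → refl) (res k' x))

    _≟H_ : ∀ {n} (x y : H n) → Dec (x ≡ y)
    _≟H_ {n} x y = map′ (λ e → trans (sym (strictlyInverseʳ x)) (trans (cong from e) (strictlyInverseʳ y)))
                        (cong to) (to x FinP.≟ to y)
      where open Inverse (enum n)

    Q : ∀ {m n} (a : H m) (b : H n) → (Fin n → Fin m) → (Fin m → Fin n) → Set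
    Q {m} {n} a b f g = Σ (∀ y → f (g y) ≡ y) λ l → Σ (∀ x → g (f x) ≡ x) λ r →
                        res (↔⇒↣ (mk↔ₛ′ f g l r)) a ≡ b

    Q? : ∀ {m n} (a : H m) (b : H n) f g → Dec (Q a b f g)
    Q? a b f g with all? (λ y → f (g y) FinP.≟ y) | all? (λ x → g (f x) FinP.≟ x)
    ... | yes l | yes r = map′ (λ e → l , r , e)
                               (λ { (l' , r' , e) → trans (res-cong _ _ (λ _ → refl) a) e })
                               (res (↔⇒↣ (mk↔ₛ′ f g l r)) a ≟H b)
    ... | no ¬l | _ = no (λ q → ¬l (proj₁ q))
    ... | yes _ | no ¬r = no (λ q → ¬r (proj₁ (proj₂ q)))

    Q-respˡ : ∀ {m n} (a : H m) (b : H n) g f f' → f ≗ f' → Q a b f g → Q a b f' g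
    Q-respˡ a b g f f' e (l , r , q) =
      (λ y → trans (sym (e (g y))) (l y)) , (λ x → trans (cong g (sym (e x))) (r x)) ,
      trans (res-cong _ _ (λ i → sym (e i)) a) q

    Q-respʳ : ∀ {m n} (a : H m) (b : H n) f g g' → g ≗ g' → Q a b f g → Q a b f g'
    Q-respʳ a b f g g' e (l , r , q) =
      (λ y → trans (cong f (sym (e y))) (l y)) , (λ x → trans (sym (e (f x))) (r x)) ,
      trans (res-cong _ _ (λ i → refl) a) q

  _∼?_ : ∀ x y → Dec (x ∼ y)
  (m , a) ∼? (n , b) =
    map′ (λ { (f , g , l , r , q) → mk↔ₛ′ f g l r , q })
         (λ { (σ , q) → Inverse.to σ , Inverse.from σ , Inverse.strictlyInverseˡ σ ,
                        Inverse.strictlyInverseʳ σ , trans (res-cong _ _ (λ _ → refl) a) q })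
         (exFun? n m (λ f → ∃ (Q a b f))
            (λ { f f' e (g , q) → g , Q-respˡ a b g f f' e q })
            (λ f → exFun? m n (Q a b f) (Q-respʳ a b f) (Q? a b f)))

  𝟙 : Obj
  𝟙 = 0 , unit

  _·_ : Obj → Obj → Obj
  (m , a) · (n , b) = (m + n) , (a ⋆ b)

  pat : Obj → Obj → ℚ
  pat a (n , b) = sumList (allSubsets n) (λ J → indicator ((cnt J , res (emb J) b) ∼? a))

  -- elements of A(h): finite Q-linear combinations of pattern functions
  Comb : Set
  Comb = List (ℚ × Obj)

  eval : Comb → Obj → ℚ
  eval c y = sumList c (λ { (q , a) → q *ℚ pat a y })

  -- sums over coinvariants of size i are taken over the canonical
  -- representative of each class: the element of H i with least index
  -- in the enumeration  enum i
  elt : ∀ i → Fin (size i) → H i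
  elt i = Inverse.from (enum i)

  Canonical : ∀ i → Fin (size i) → Set
  Canonical i r = ¬ (∃ λ r' → r' < r × ((i , elt i r') ∼ (i , elt i r)))

  canonical? : ∀ i r → Dec (Canonical i r)
  canonical? i r = ¬? (any? (λ r' → (r' <? r) ×-dec ((i , elt i r') ∼? (i , elt i r))))

  sumCoinv : ℕ → (Obj → ℚ) → ℚ
  sumCoinv k f = sumFin (suc k) λ i → sumFin (size (Data.Fin.toℕ i)) λ r →
                 indicator (canonical? (Data.Fin.toℕ i) r) *ℚ f (Data.Fin.toℕ i , elt (Data.Fin.toℕ i) r)

  -- Δ p_a = Σ_{b · c = a} p_b ⊗ p_c, an element of A(h) ⊗ A(h) represented
  -- as a function on pairs of coinvariants (y , z) ↦ Σ p_b(y) p_c(z)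
  Δpat : Obj → Obj → Obj → ℚ
  Δpat (k , a) y z = sumCoinv k λ b → sumCoinv k λ c →
                     indicator ((b · c) ∼? (k , a)) *ℚ (pat b y *ℚ pat c z)

  Δ : Comb → Obj → Obj → ℚ
  Δ c y z = sumList c (λ { (q , a) → q *ℚ Δpat a y z })

  Primitive : Comb → Set
  Primitive x = ∀ y z → Δ x y z ≡ (eval x y *ℚ pat 𝟙 z) +ℚ (pat 𝟙 y *ℚ eval x z)

  Irreducible : Obj → Set
  Irreducible t = ¬ (t ∼ 𝟙) × (∀ a b → (a · b) ∼ t → (a ∼ 𝟙) ⊎ (b ∼ 𝟙))

  InIrrSpan : Comb → Set
  InIrrSpan x = Σ Comb λ w → AllIrr w × (∀ y → eval w y ≡ eval x y)
    where
    AllIrr : Comb → Set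
    AllIrr [] = Data.Unit.⊤ where import Data.Unit
    AllIrr ((q , a) ∷ w) = Irreducible a × AllIrr w

-- Evaluated at a pair of objects, the coproduct is dual to the product: Δ p_a (y , z) = p_a (y · z),
-- because a restriction of y · z is the product of a restriction of y and one of z (naturality of ⋆),
-- and summing over the factorisations b · c = a only regroups these restrictions.  As p_𝟙 is constantly
-- 1 (connectedness), x is primitive exactly when it is additive as a function on objects:
-- x (y · z) = x y + x z.  For irreducible a, a restriction of y · z is a copy of a only if it lies
-- entirely inside y or entirely inside z, so p_a is additive.  Conversely, split an additive x into a
-- combination w of irreducible patterns and a combination r of reducible ones.  Then r is additive and
-- r t = Σ_{J} κ (t|_J), where κ s is the total coefficient of the class of s in r.  By strong induction
-- on size κ vanishes: if s ≅ 𝟙 then κ s = r 𝟙 = 0, and if s ≅ b · c with b, c nontrivial then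
-- κ s = r (b · c) = r b + r c = 0.  Hence x = w.

module Submission where

open import Defs

open import Algebra.Bundles using (CommutativeMonoid)
import Algebra.Properties.CommutativeSemigroup as CommSemigroupProperties
open import Data.Bool using (Bool; true; false)
open import Data.Empty using (⊥; ⊥-elim)
open import Data.Fin as Fin using (Fin; zero; suc; toℕ; _↑ˡ_; _↑ʳ_; cast)
import Data.Fin.Induction as FinInd
open import Data.Fin.Permutation using (↔⇒≡)
import Data.Fin.Properties as FinP
open import Data.List as List using (List; []; _∷_; map; tabulate; allFin)
open import Data.List.Relation.Unary.All using (All; []; _∷_)
open import Data.Nat as ℕ using (ℕ; zero; suc; _≤_; _<_; z≤n; s≤s)
open import Data.Nat.Induction using (<-rec)
import Data.Nat.Properties as ℕP
open import Data.Product using (Σ; ∃; ∃₂; _×_; _,_; proj₁; proj₂)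
open import Data.Rational using (ℚ; 0ℚ; 1ℚ; _+_; _*_)
import Data.Rational.Properties as ℚP
open import Data.Sum using (_⊎_; inj₁; inj₂; [_,_]′)
open import Data.Sum.Function.Propositional using (_⊎-↔_)
open import Data.Vec as Vec using (Vec; []; _∷_; _++_; replicate)
open import Function using (_∘_; id)
open import Function.Bundles using (_⇔_; mk⇔; _↣_; _↔_; Injection; Inverse; mk↣)
open import Function.Construct.Composition using (_↔-∘_; _⇔-∘_)
open import Function.Construct.Identity using (↔-id)
open import Function.Construct.Symmetry using (↔-sym)
open import Function.Properties.Inverse using (↔⇒↣)
import Induction.WellFounded as WF
open import Level using (0ℓ)
open import Relation.Binary using (tri<; tri≈; tri>; _Preserves_⟶_)
open import Relation.Binary.PropositionalEquality
open import Relation.Nullary using (Dec; yes; no; ¬_; ¬?; _×-dec_)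
open import Relation.Nullary.Decidable using (map′)

open CommSemigroupProperties (CommutativeMonoid.commutativeSemigroup ℚP.+-0-commutativeMonoid)
  using () renaming (interchange to +-interchange; x∙yz≈y∙xz to +-lcomm)
open CommSemigroupProperties (CommutativeMonoid.commutativeSemigroup ℚP.*-1-commutativeMonoid)
  using () renaming (x∙yz≈y∙xz to *-lcomm)
open import Algebra.Properties.Group ℚP.+-0-group using () renaming (∙-cancelˡ to +-cancelˡ)

private variable A B : Set

sumList-cong : ∀ xs {f g : A → ℚ} → (∀ x → f x ≡ g x) → sumList xs f ≡ sumList xs g
sumList-cong []       f≗g = refl
sumList-cong (x ∷ xs) f≗g = cong₂ _+_ (f≗g x) (sumList-cong xs f≗g)

sumList-zero : ∀ xs {f : A → ℚ} → (∀ x → f x ≡ 0ℚ) → sumList xs f ≡ 0ℚ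
sumList-zero []       f≗0 = refl
sumList-zero (x ∷ xs) f≗0 = cong₂ _+_ (f≗0 x) (sumList-zero xs f≗0)

sumList-++ : ∀ xs ys (f : A → ℚ) → sumList (xs List.++ ys) f ≡ sumList xs f + sumList ys f
sumList-++ []       ys f = sym (ℚP.+-identityˡ _)
sumList-++ (x ∷ xs) ys f = trans (cong (f x +_) (sumList-++ xs ys f)) (sym (ℚP.+-assoc (f x) _ _))

sumList-+ : ∀ xs (f g : A → ℚ) → sumList xs (λ x → f x + g x) ≡ sumList xs f + sumList xs g
sumList-+ []       f g = refl
sumList-+ (x ∷ xs) f g = trans (cong (f x + g x +_) (sumList-+ xs f g)) (+-interchange (f x) (g x) _ _)

sumList-*ˡ : ∀ xs q (f : A → ℚ) → sumList xs (λ x → q * f x) ≡ q * sumList xs f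
sumList-*ˡ []       q f = sym (ℚP.*-zeroʳ q)
sumList-*ˡ (x ∷ xs) q f = trans (cong (q * f x +_) (sumList-*ˡ xs q f)) (sym (ℚP.*-distribˡ-+ q (f x) _))

sumList-*ʳ : ∀ xs q (f : A → ℚ) → sumList xs (λ x → f x * q) ≡ sumList xs f * q
sumList-*ʳ xs q f = trans (sumList-cong xs (λ x → ℚP.*-comm (f x) q))
                          (trans (sumList-*ˡ xs q f) (ℚP.*-comm q _))

sumList-map : ∀ (g : A → B) xs (f : B → ℚ) → sumList (map g xs) f ≡ sumList xs (f ∘ g)
sumList-map g []       f = refl
sumList-map g (x ∷ xs) f = cong (f (g x) +_) (sumList-map g xs f)

sumList-comm : ∀ (xs : List A) (ys : List B) (f : A → B → ℚ) →
               sumList xs (λ x → sumList ys (f x)) ≡ sumList ys (λ y → sumList xs (λ x → f x y))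
sumList-comm []       ys f = sym (sumList-zero ys (λ _ → refl))
sumList-comm (x ∷ xs) ys f = trans (cong (sumList ys (f x) +_) (sumList-comm xs ys f)) (sym (sumList-+ ys (f x) _))

sumList-*-sumList : ∀ (xs : List A) (ys : List B) (f : A → ℚ) (g : B → ℚ) →
                    sumList xs f * sumList ys g ≡ sumList xs (λ x → sumList ys (λ y → f x * g y))
sumList-*-sumList xs ys f g = trans (sym (sumList-*ʳ xs _ f))
  (sumList-cong xs (λ x → sym (sumList-*ˡ ys (f x) g)))

sumFin-tabulate : ∀ n (g : Fin n → B) (f : B → ℚ) → sumFin n (f ∘ g) ≡ sumList (tabulate g) f
sumFin-tabulate zero    g f = refl
sumFin-tabulate (suc n) g f = cong (f (g zero) +_) (sumFin-tabulate n (g ∘ suc) f)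

sumFin-as-sumList : ∀ n (f : Fin n → ℚ) → sumFin n f ≡ sumList (allFin n) f
sumFin-as-sumList n = sumFin-tabulate n id

sumFin-cong : ∀ n {f g : Fin n → ℚ} → (∀ i → f i ≡ g i) → sumFin n f ≡ sumFin n g
sumFin-cong zero    f≗g = refl
sumFin-cong (suc n) f≗g = cong₂ _+_ (f≗g zero) (sumFin-cong n (f≗g ∘ suc))

sumFin-zero : ∀ n {f : Fin n → ℚ} → (∀ i → f i ≡ 0ℚ) → sumFin n f ≡ 0ℚ
sumFin-zero n {f} f≗0 = trans (sumFin-as-sumList n f) (sumList-zero (allFin n) f≗0)

sumFin-*ˡ : ∀ n q (f : Fin n → ℚ) → sumFin n (λ i → q * f i) ≡ q * sumFin n f
sumFin-*ˡ n q f = trans (sumFin-as-sumList n _)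
  (trans (sumList-*ˡ (allFin n) q f) (cong (q *_) (sym (sumFin-as-sumList n f))))

sumFin-sumList-comm : ∀ n (ys : List B) (f : Fin n → B → ℚ) →
                      sumFin n (λ i → sumList ys (f i)) ≡ sumList ys (λ y → sumFin n (λ i → f i y))
sumFin-sumList-comm n ys f = trans (sumFin-as-sumList n _) (trans (sumList-comm (allFin n) ys f)
  (sumList-cong ys (λ y → sym (sumFin-as-sumList n (λ i → f i y)))))

sumFin-single : ∀ n (i₀ : Fin n) (f : Fin n → ℚ) → (∀ i → i ≢ i₀ → f i ≡ 0ℚ) → sumFin n f ≡ f i₀
sumFin-single (suc n) zero     f f≗0 =
  trans (cong (f zero +_) (sumFin-zero n (λ i → f≗0 (suc i) (λ ())))) (ℚP.+-identityʳ _)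
sumFin-single (suc n) (suc i₀) f f≗0 =
  trans (cong₂ _+_ (f≗0 zero (λ ()))
                   (sumFin-single n i₀ (f ∘ suc) (λ i i≢i₀ → f≗0 (suc i) (i≢i₀ ∘ FinP.suc-injective))))
        (ℚP.+-identityˡ _)

sumFin-toℕ-single : ∀ n (f : ℕ → ℚ) m → (∀ j → j ≢ m → f j ≡ 0ℚ) → (n ≤ m → f m ≡ 0ℚ) →
                    sumFin n (f ∘ toℕ) ≡ f m
sumFin-toℕ-single zero    f m       f≗0 f[m]≡0 = sym (f[m]≡0 z≤n)
sumFin-toℕ-single (suc n) f zero    f≗0 f[m]≡0 =
  trans (cong (f 0 +_) (sumFin-zero n (λ i → f≗0 (suc (toℕ i)) (λ ())))) (ℚP.+-identityʳ _)
sumFin-toℕ-single (suc n) f (suc m) f≗0 f[m]≡0 =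
  trans (cong₂ _+_ (f≗0 0 (λ ())) (sumFin-toℕ-single n (f ∘ suc) m (λ j j≢m → f≗0 (suc j) (j≢m ∘ ℕP.suc-injective))
                                                                     (f[m]≡0 ∘ s≤s)))
        (ℚP.+-identityˡ _)

indicator-yes : ∀ {P : Set} (P? : Dec P) → P → indicator P? ≡ 1ℚ
indicator-yes (yes _) _ = refl
indicator-yes (no ¬p) p = ⊥-elim (¬p p)

indicator-no : ∀ {P : Set} (P? : Dec P) → ¬ P → indicator P? ≡ 0ℚ
indicator-no (yes p) ¬p = ⊥-elim (¬p p)
indicator-no (no _)  _  = refl

indicator-cong : ∀ {P Q : Set} (P? : Dec P) (Q? : Dec Q) → (P → Q) → (Q → P) → indicator P? ≡ indicator Q?
indicator-cong (yes p) Q? P→Q Q→P = sym (indicator-yes Q? (P→Q p))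
indicator-cong (no ¬p) Q? P→Q Q→P = sym (indicator-no Q? (¬p ∘ Q→P))

indicator-*-indicator≡0 : ∀ {P Q : Set} (P? : Dec P) (Q? : Dec Q) v → (P → Q → ⊥) →
                          indicator P? * (indicator Q? * v) ≡ 0ℚ
indicator-*-indicator≡0 (no _)  Q?     v _     = ℚP.*-zeroˡ (indicator Q? * v)
indicator-*-indicator≡0 (yes _) (no _) v _     = trans (ℚP.*-identityˡ (0ℚ * v)) (ℚP.*-zeroˡ v)
indicator-*-indicator≡0 (yes p) (yes q) v ¬p×q = ⊥-elim (¬p×q p q)

full : ∀ n → Vec Bool n
full n = replicate n true

empty : ∀ n → Vec Bool n
empty n = replicate n false

cnt-++ : ∀ {m n} (J₁ : Vec Bool m) (J₂ : Vec Bool n) → cnt (J₁ ++ J₂) ≡ cnt J₁ ℕ.+ cnt J₂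
cnt-++ []           J₂ = refl
cnt-++ (true ∷ J₁)  J₂ = cong suc (cnt-++ J₁ J₂)
cnt-++ (false ∷ J₁) J₂ = cnt-++ J₁ J₂

cnt-full : ∀ n → cnt (full n) ≡ n
cnt-full zero    = refl
cnt-full (suc n) = cong suc (cnt-full n)

cnt-empty : ∀ n → cnt (empty n) ≡ 0
cnt-empty zero    = refl
cnt-empty (suc n) = cnt-empty n

cnt≡0⇒empty : ∀ {n} (J : Vec Bool n) → cnt J ≡ 0 → J ≡ empty n
cnt≡0⇒empty []          _     = refl
cnt≡0⇒empty (false ∷ J) cnt≡0 = cong (false ∷_) (cnt≡0⇒empty J cnt≡0)

cnt≤ : ∀ {n} (J : Vec Bool n) → cnt J ≤ n
cnt≤ []          = z≤n
cnt≤ (true ∷ J)  = s≤s (cnt≤ J)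
cnt≤ (false ∷ J) = ℕP.m≤n⇒m≤1+n (cnt≤ J)

cnt<-proper : ∀ {n} (J : Vec Bool n) → J ≢ full n → cnt J < n
cnt<-proper []          J≢full = ⊥-elim (J≢full refl)
cnt<-proper (true ∷ J)  J≢full = s≤s (cnt<-proper J (J≢full ∘ cong (true ∷_)))
cnt<-proper (false ∷ J) J≢full = s≤s (cnt≤ J)

embF-full : ∀ n .(e : n ≡ cnt (full n)) i → embF (full n) (cast e i) ≡ i
embF-full (suc n) e zero    = refl
embF-full (suc n) e (suc i) = cong suc (embF-full n _ i)

-- cnt (J₁ ++ J₂) is only propositionally equal to cnt J₁ + cnt J₂, hence the casts.
embF-++-↑ˡ : ∀ {m n} (J₁ : Vec Bool m) (J₂ : Vec Bool n) .(e : cnt J₁ ℕ.+ cnt J₂ ≡ cnt (J₁ ++ J₂)) i →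
             embF (J₁ ++ J₂) (cast e (i ↑ˡ cnt J₂)) ≡ embF J₁ i ↑ˡ n
embF-++-↑ˡ (true ∷ J₁)  J₂ e zero    = refl
embF-++-↑ˡ (true ∷ J₁)  J₂ e (suc i) = cong suc (embF-++-↑ˡ J₁ J₂ _ i)
embF-++-↑ˡ (false ∷ J₁) J₂ e i       = cong suc (embF-++-↑ˡ J₁ J₂ e i)

embF-++-↑ʳ : ∀ {m n} (J₁ : Vec Bool m) (J₂ : Vec Bool n) .(e : cnt J₁ ℕ.+ cnt J₂ ≡ cnt (J₁ ++ J₂)) j →
             embF (J₁ ++ J₂) (cast e (cnt J₁ ↑ʳ j)) ≡ m ↑ʳ embF J₂ j
embF-++-↑ʳ []           J₂ e j = cong (embF J₂) (FinP.cast-is-id e j)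
embF-++-↑ʳ (true ∷ J₁)  J₂ e j = cong suc (embF-++-↑ʳ J₁ J₂ _ j)
embF-++-↑ʳ (false ∷ J₁) J₂ e j = cong suc (embF-++-↑ʳ J₁ J₂ e j)

sum-subsets-suc : ∀ n (f : Vec Bool (suc n) → ℚ) →
  sumList (allSubsets (suc n)) f ≡ sumList (allSubsets n) (f ∘ (true ∷_)) + sumList (allSubsets n) (f ∘ (false ∷_))
sum-subsets-suc n f = trans (sumList-++ (map (true ∷_) (allSubsets n)) _ f)
  (cong₂ _+_ (sumList-map (true ∷_) (allSubsets n) f) (sumList-map (false ∷_) (allSubsets n) f))

sum-subsets-single : ∀ n (T : Vec Bool n) (f : Vec Bool n → ℚ) → (∀ J → J ≢ T → f J ≡ 0ℚ) →
                     sumList (allSubsets n) f ≡ f T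
sum-subsets-single zero    []          f f≗0 = ℚP.+-identityʳ (f [])
sum-subsets-single (suc n) (true ∷ T)  f f≗0 = trans (sum-subsets-suc n f)
  (trans (cong₂ _+_ (sum-subsets-single n T (f ∘ (true ∷_)) (λ J J≢T → f≗0 _ (J≢T ∘ cong Vec.tail)))
                    (sumList-zero (allSubsets n) (λ J → f≗0 _ (λ ()))))
         (ℚP.+-identityʳ _))
sum-subsets-single (suc n) (false ∷ T) f f≗0 = trans (sum-subsets-suc n f)
  (trans (cong₂ _+_ (sumList-zero (allSubsets n) (λ J → f≗0 _ (λ ())))
                    (sum-subsets-single n T (f ∘ (false ∷_)) (λ J J≢T → f≗0 _ (J≢T ∘ cong Vec.tail))))
         (ℚP.+-identityˡ _))

sum-subsets-++ : ∀ m n (f : Vec Bool (m ℕ.+ n) → ℚ) →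
  sumList (allSubsets (m ℕ.+ n)) f ≡ sumList (allSubsets m) (λ J₁ → sumList (allSubsets n) (λ J₂ → f (J₁ ++ J₂)))
sum-subsets-++ zero    n f = sym (ℚP.+-identityʳ _)
sum-subsets-++ (suc m) n f = trans (sum-subsets-suc (m ℕ.+ n) f)
  (trans (cong₂ _+_ (sum-subsets-++ m n (f ∘ (true ∷_))) (sum-subsets-++ m n (f ∘ (false ∷_))))
         (sym (sum-subsets-suc m (λ J₁ → sumList (allSubsets n) (λ J₂ → f (J₁ ++ J₂))))))

cast-injective : ∀ {m n} .(e : m ≡ n) {i j : Fin m} → cast e i ≡ cast e j → i ≡ j
cast-injective e {i} {j} eq = begin
  i                        ≡⟨ FinP.cast-involutive (sym e) e i ⟨
  cast (sym e) (cast e i)  ≡⟨ cong (cast (sym e)) eq ⟩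
  cast (sym e) (cast e j)  ≡⟨ FinP.cast-involutive (sym e) e j ⟩
  j                        ∎
  where open ≡-Reasoning

_⊕_ : ∀ {p q m n} → Fin p ↔ Fin m → Fin q ↔ Fin n → Fin (p ℕ.+ q) ↔ Fin (m ℕ.+ n)
σ ⊕ τ = ↔-sym FinP.+↔⊎ ↔-∘ ((σ ⊎-↔ τ) ↔-∘ FinP.+↔⊎)

⊕-↑ˡ : ∀ {p q m n} (σ : Fin p ↔ Fin m) (τ : Fin q ↔ Fin n) i → Inverse.to (σ ⊕ τ) (i ↑ˡ q) ≡ Inverse.to σ i ↑ˡ n
⊕-↑ˡ {p} {q} σ τ i rewrite FinP.splitAt-↑ˡ p i q = refl

⊕-↑ʳ : ∀ {p q m n} (σ : Fin p ↔ Fin m) (τ : Fin q ↔ Fin n) j → Inverse.to (σ ⊕ τ) (p ↑ʳ j) ≡ m ↑ʳ Inverse.to τ j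
⊕-↑ʳ {p} {q} σ τ j rewrite FinP.splitAt-↑ʳ p q j = refl

module _ (h : AssocPresheaf) where
  open AssocPresheaf h
  open Presheaf presheaf

  _≈_ : Obj h → Obj h → Set
  _≈_ = _∼_ h

  _≈?_ : ∀ u v → Dec (u ≈ v)
  _≈?_ = _∼?_ h

  _∙_ : Obj h → Obj h → Obj h
  _∙_ = _·_ h

  𝟏 : Obj h
  𝟏 = 𝟙 h

  _↾_ : ∀ {n} → H n → Vec Bool n → Obj h
  t ↾ J = cnt J , res (emb J) t

  res-cong : ∀ {m n} (k k′ : Fin m ↣ Fin n) → (∀ i → Injection.to k i ≡ Injection.to k′ i) → ∀ x → res k x ≡ res k′ x
  res-cong k k′ k≗k′ x = trans (res-∘ k′ (mk↣ id) k k≗k′ x) (res-id (mk↣ id) (λ _ → refl) (res k′ x))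

  res-reindex : ∀ {p q N} (e : p ≡ q) (k : Fin q ↣ Fin N) (k′ : Fin p ↣ Fin N) →
                (∀ i → Injection.to k′ i ≡ Injection.to k (cast e i)) → ∀ x →
                _≡_ {A = Obj h} (q , res k x) (p , res k′ x)
  res-reindex refl k k′ k′≗k∘cast x =
    cong (_ ,_) (res-cong k k′ (λ i → sym (trans (k′≗k∘cast i) (cong (Injection.to k) (FinP.cast-is-id refl i)))) x)

  ≈-refl : ∀ {u} → u ≈ u
  ≈-refl {m , a} = ↔-id _ , res-id _ (λ _ → refl) a

  ≈-reflexive : ∀ {u v} → u ≡ v → u ≈ v
  ≈-reflexive refl = ≈-refl

  ≈-sym : ∀ {u v} → u ≈ v → v ≈ u
  ≈-sym {m , a} {n , b} (σ , σa≡b) = ↔-sym σ , (begin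
    res (↔⇒↣ (↔-sym σ)) b
      ≡⟨ cong (res _) σa≡b ⟨
    res (↔⇒↣ (↔-sym σ)) (res (↔⇒↣ σ) a)
      ≡⟨ res-∘ (↔⇒↣ σ) (↔⇒↣ (↔-sym σ)) (mk↣ id) (λ i → sym (Inverse.strictlyInverseˡ σ i)) a ⟨
    res (mk↣ id) a
      ≡⟨ res-id (mk↣ id) (λ _ → refl) a ⟩
    a ∎)
    where open ≡-Reasoning

  ≈-trans : ∀ {u v w} → u ≈ v → v ≈ w → u ≈ w
  ≈-trans {l , a} (σ , σa≡b) (τ , τb≡c) =
    σ ↔-∘ τ , trans (res-∘ (↔⇒↣ σ) (↔⇒↣ τ) (↔⇒↣ (σ ↔-∘ τ)) (λ _ → refl) a) (trans (cong (res _) σa≡b) τb≡c)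

  ≈-size : ∀ {u v} → u ≈ v → proj₁ u ≡ proj₁ v
  ≈-size (σ , _) = sym (↔⇒≡ σ)

  ∙-cong : ∀ {u u′ v v′} → u ≈ u′ → v ≈ v′ → (u ∙ v) ≈ (u′ ∙ v′)
  ∙-cong {m , a} {v = n , b} (σ , σa≡a′) (τ , τb≡b′) =
    σ ⊕ τ , trans (⋆-natural (↔⇒↣ σ) (↔⇒↣ τ) (↔⇒↣ (σ ⊕ τ)) (⊕-↑ˡ σ τ) (⊕-↑ʳ σ τ) a b) (cong₂ _⋆_ σa≡a′ τb≡b′)

  ↾-full : ∀ {n} (t : H n) → t ↾ full n ≡ (n , t)
  ↾-full {n} t = trans (res-reindex (sym (cnt-full n)) (emb (full n)) (mk↣ id) (λ i → sym (embF-full n _ i)) t)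
                       (cong (n ,_) (res-id (mk↣ id) (λ _ → refl) t))

  ↾-++ : ∀ {m n} (y : H m) (z : H n) (J₁ : Vec Bool m) (J₂ : Vec Bool n) → (y ⋆ z) ↾ (J₁ ++ J₂) ≡ (y ↾ J₁) ∙ (z ↾ J₂)
  ↾-++ y z J₁ J₂ = trans (res-reindex e (emb (J₁ ++ J₂)) k (λ _ → refl) (y ⋆ z))
    (cong (_ ,_) (⋆-natural (emb J₁) (emb J₂) k (embF-++-↑ˡ J₁ J₂ e) (embF-++-↑ʳ J₁ J₂ e) y z))
    where
    e : cnt J₁ ℕ.+ cnt J₂ ≡ cnt (J₁ ++ J₂)
    e = sym (cnt-++ J₁ J₂)
    k : Fin (cnt J₁ ℕ.+ cnt J₂) ↣ Fin _
    k = mk↣ (cast-injective e ∘ embF-inj (J₁ ++ J₂))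

  canonical-representative : ∀ m r → ∃ λ r′ → Canonical h m r′ × (m , elt h m r′) ≈ (m , elt h m r)
  canonical-representative m = WF.All.wfRec FinInd.<-wellFounded 0ℓ _ descend
    where
    Rep : Fin (size m) → Set
    Rep r = ∃ λ r′ → Canonical h m r′ × (m , elt h m r′) ≈ (m , elt h m r)
    descend : ∀ r → WF.WfRec Fin._<_ Rep r → Rep r
    descend r smaller with FinP.any? (λ r′ → (r′ FinP.<? r) ×-dec ((m , elt h m r′) ≈? (m , elt h m r)))
    ... | no ¬smaller = r , ¬smaller , ≈-refl
    ... | yes (r′ , r′<r , r′≈r) with smaller r′<r
    ...   | r″ , canonical , r″≈r′ = r″ , canonical , ≈-trans r″≈r′ r′≈r

  canonical-unique : ∀ {m r r′} → Canonical h m r → Canonical h m r′ → (m , elt h m r) ≈ (m , elt h m r′) → r ≡ r′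
  canonical-unique {r = r} {r′} canonical canonical′ r≈r′ with FinP.<-cmp r r′
  ... | tri< r<r′ _ _ = ⊥-elim (canonical′ (r , r<r′ , r≈r′))
  ... | tri≈ _ r≡r′ _ = r≡r′
  ... | tri> _ _ r′<r = ⊥-elim (canonical (r′ , r′<r , ≈-sym r≈r′))

  -- sumCoinv h k f unfolds to sumFin (suc k) (λ i → sumClass (toℕ i) f).
  sumClass : ℕ → (Obj h → ℚ) → ℚ
  sumClass j f = sumFin (size j) (λ r → indicator (canonical? h j r) * f (j , elt h j r))

  sumClass-cong : ∀ j {f g : Obj h → ℚ} → (∀ u → f u ≡ g u) → sumClass j f ≡ sumClass j g
  sumClass-cong j f≗g = sumFin-cong (size j) λ r → cong (indicator (canonical? h j r) *_) (f≗g (j , elt h j r))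

  sumClass-*ˡ : ∀ j q (f : Obj h → ℚ) → sumClass j (λ u → q * f u) ≡ q * sumClass j f
  sumClass-*ˡ j q f = trans (sumFin-cong (size j) λ r → *-lcomm (indicator (canonical? h j r)) q (f (j , elt h j r)))
                            (sumFin-*ˡ (size j) q (λ r → indicator (canonical? h j r) * f (j , elt h j r)))

  sumClass-sumList-comm : ∀ j (ys : List B) (f : Obj h → B → ℚ) →
    sumClass j (λ u → sumList ys (f u)) ≡ sumList ys (λ y → sumClass j (λ u → f u y))
  sumClass-sumList-comm j ys f =
    trans (sumFin-cong (size j) λ r → sym (sumList-*ˡ ys (indicator (canonical? h j r)) (f (j , elt h j r))))
          (sumFin-sumList-comm (size j) ys λ r y → indicator (canonical? h j r) * f (j , elt h j r) y)

  sumCoinv-cong : ∀ k {f g : Obj h → ℚ} → (∀ u → f u ≡ g u) → sumCoinv h k f ≡ sumCoinv h k g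
  sumCoinv-cong k f≗g = sumFin-cong (suc k) λ i → sumClass-cong (toℕ i) f≗g

  sumCoinv-*ˡ : ∀ k q (f : Obj h → ℚ) → sumCoinv h k (λ u → q * f u) ≡ q * sumCoinv h k f
  sumCoinv-*ˡ k q f = trans (sumFin-cong (suc k) λ i → sumClass-*ˡ (toℕ i) q f)
                            (sumFin-*ˡ (suc k) q λ i → sumClass (toℕ i) f)

  sumCoinv-sumList-comm : ∀ k (ys : List B) (f : Obj h → B → ℚ) →
    sumCoinv h k (λ u → sumList ys (f u)) ≡ sumList ys (λ y → sumCoinv h k (λ u → f u y))
  sumCoinv-sumList-comm k ys f = trans (sumFin-cong (suc k) λ i → sumClass-sumList-comm (toℕ i) ys f)
                                       (sumFin-sumList-comm (suc k) ys λ i y → sumClass (toℕ i) (λ u → f u y))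

  sumClass-sift-other : ∀ j u (f : Obj h → ℚ) → j ≢ proj₁ u → sumClass j (λ c → indicator (u ≈? c) * f c) ≡ 0ℚ
  sumClass-sift-other j u f j≢u = sumFin-zero (size j) λ r →
    indicator-*-indicator≡0 (canonical? h j r) (u ≈? (j , elt h j r)) (f (j , elt h j r))
      λ _ u≈r → j≢u (sym (≈-size u≈r))

  sumClass-sift-self : ∀ u (f : Obj h → ℚ) → f Preserves _≈_ ⟶ _≡_ →
                       sumClass (proj₁ u) (λ c → indicator (u ≈? c) * f c) ≡ f u
  sumClass-sift-self (m , x) f f-resp with canonical-representative m (Inverse.to (enum m) x)
  ... | r₀ , canonical₀ , r₀≈x′ = begin
    sumFin (size m) term
      ≡⟨ sumFin-single (size m) r₀ term off-r₀ ⟩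
    term r₀
      ≡⟨ cong₂ (λ s t → s * (t * f (o r₀)))
               (indicator-yes (canonical? h m r₀) canonical₀) (indicator-yes (u ≈? o r₀) (≈-sym r₀≈u)) ⟩
    1ℚ * (1ℚ * f (o r₀))
      ≡⟨ trans (ℚP.*-identityˡ (1ℚ * f (o r₀))) (ℚP.*-identityˡ (f (o r₀))) ⟩
    f (o r₀)
      ≡⟨ f-resp r₀≈u ⟩
    f u ∎
    where
    open ≡-Reasoning
    u : Obj h
    u = m , x
    o : Fin (size m) → Obj h
    o r = m , elt h m r
    term : Fin (size m) → ℚ
    term r = indicator (canonical? h m r) * (indicator (u ≈? o r) * f (o r))
    r₀≈u : o r₀ ≈ u
    r₀≈u = ≈-trans r₀≈x′ (≈-reflexive (cong (m ,_) (Inverse.strictlyInverseʳ (enum m) x)))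
    off-r₀ : ∀ r → r ≢ r₀ → term r ≡ 0ℚ
    off-r₀ r r≢r₀ = indicator-*-indicator≡0 (canonical? h m r) (u ≈? o r) (f (o r))
      λ canonical u≈r → r≢r₀ (canonical-unique canonical canonical₀ (≈-trans (≈-sym u≈r) (≈-sym r₀≈u)))

  sumCoinv-sift : ∀ k u (f : Obj h → ℚ) → f Preserves _≈_ ⟶ _≡_ → (k < proj₁ u → f u ≡ 0ℚ) →
                  sumCoinv h k (λ c → indicator (u ≈? c) * f c) ≡ f u
  sumCoinv-sift k u f f-resp f-vanishes = trans
    (sumFin-toℕ-single (suc k) (λ j → sumClass j (λ c → indicator (u ≈? c) * f c)) (proj₁ u)
      (λ j j≢u → sumClass-sift-other j u f j≢u)
      (λ k<u → trans (sumClass-sift-self u f f-resp) (f-vanishes k<u)))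
    (sumClass-sift-self u f f-resp)

  pat-∙ : ∀ a {m n} (y : H m) (z : H n) → pat h a ((m , y) ∙ (n , z)) ≡
          sumList (allSubsets m) (λ J₁ → sumList (allSubsets n) (λ J₂ → indicator (((y ↾ J₁) ∙ (z ↾ J₂)) ≈? a)))
  pat-∙ a {m} {n} y z = trans (sum-subsets-++ m n (λ J → indicator (((y ⋆ z) ↾ J) ≈? a)))
    (sumList-cong (allSubsets m) λ J₁ → sumList-cong (allSubsets n) λ J₂ →
      cong (λ u → indicator (u ≈? a)) (↾-++ y z J₁ J₂))

  sumCoinv-pat : ∀ k {n} (z : H n) (f : Obj h → ℚ) → f Preserves _≈_ ⟶ _≡_ → (∀ c → k < proj₁ c → f c ≡ 0ℚ) →
                 sumCoinv h k (λ c → pat h c (n , z) * f c) ≡ sumList (allSubsets n) (λ J → f (z ↾ J))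
  sumCoinv-pat k {n} z f f-resp f-vanishes = begin
    sumCoinv h k (λ c → pat h c (n , z) * f c)
      ≡⟨ sumCoinv-cong k (λ c → sym (sumList-*ʳ (allSubsets n) (f c) (λ J → indicator ((z ↾ J) ≈? c)))) ⟩
    sumCoinv h k (λ c → sumList (allSubsets n) (λ J → indicator ((z ↾ J) ≈? c) * f c))
      ≡⟨ sumCoinv-sumList-comm k (allSubsets n) (λ c J → indicator ((z ↾ J) ≈? c) * f c) ⟩
    sumList (allSubsets n) (λ J → sumCoinv h k (λ c → indicator ((z ↾ J) ≈? c) * f c))
      ≡⟨ sumList-cong (allSubsets n) (λ J → sumCoinv-sift k (z ↾ J) f f-resp (f-vanishes (z ↾ J))) ⟩
    sumList (allSubsets n) (λ J → f (z ↾ J)) ∎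
    where open ≡-Reasoning

  Δpat-pat : ∀ a y z → Δpat h a y z ≡ pat h a (y ∙ z)
  Δpat-pat (k , α) (m , y) (n , z) = begin
    sumCoinv h k (λ b → sumCoinv h k (λ c → X b c * (pat h b (m , y) * pat h c (n , z))))
      ≡⟨ sumCoinv-cong k (λ b → trans (sumCoinv-cong k (λ c → rearrange (X b c) (pat h b (m , y)) (pat h c (n , z))))
                                      (sumCoinv-*ˡ k (pat h b (m , y)) (λ c → pat h c (n , z) * X b c))) ⟩
    sumCoinv h k (λ b → pat h b (m , y) * sumCoinv h k (λ c → pat h c (n , z) * X b c))
      ≡⟨ sumCoinv-cong k (λ b → cong (pat h b (m , y) *_) (sum-over-c b)) ⟩
    sumCoinv h k (λ b → pat h b (m , y) * sumList (allSubsets n) (λ J₂ → X b (z ↾ J₂)))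
      ≡⟨ sumCoinv-pat k y (λ b → sumList (allSubsets n) (λ J₂ → X b (z ↾ J₂)))
           (λ b≈b′ → sumList-cong (allSubsets n) (λ J₂ → X-respˡ (z ↾ J₂) b≈b′))
           (λ b k<b → sumList-zero (allSubsets n) (λ J₂ → X-vanish b (z ↾ J₂) (ℕP.m≤n⇒m≤n+o (cnt J₂) k<b))) ⟩
    sumList (allSubsets m) (λ J₁ → sumList (allSubsets n) (λ J₂ → X (y ↾ J₁) (z ↾ J₂)))
      ≡⟨ pat-∙ (k , α) y z ⟨
    pat h (k , α) ((m , y) ∙ (n , z)) ∎
    where
    open ≡-Reasoning
    X : Obj h → Obj h → ℚ
    X b c = indicator ((b ∙ c) ≈? (k , α))
    X-respˡ : ∀ c {b b′} → b ≈ b′ → X b c ≡ X b′ c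
    X-respˡ c {b} {b′} b≈b′ = indicator-cong ((b ∙ c) ≈? (k , α)) ((b′ ∙ c) ≈? (k , α))
      (≈-trans (∙-cong (≈-sym b≈b′) ≈-refl)) (≈-trans (∙-cong b≈b′ ≈-refl))
    X-respʳ : ∀ b {c c′} → c ≈ c′ → X b c ≡ X b c′
    X-respʳ b {c} {c′} c≈c′ = indicator-cong ((b ∙ c) ≈? (k , α)) ((b ∙ c′) ≈? (k , α))
      (≈-trans (∙-cong ≈-refl (≈-sym c≈c′))) (≈-trans (∙-cong ≈-refl c≈c′))
    X-vanish : ∀ b c → k < proj₁ b ℕ.+ proj₁ c → X b c ≡ 0ℚ
    X-vanish b c k<b+c = indicator-no ((b ∙ c) ≈? (k , α)) (λ bc≈a → ℕP.<-irrefl (sym (≈-size bc≈a)) k<b+c)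
    rearrange : ∀ x p q → x * (p * q) ≡ p * (q * x)
    rearrange x p q = trans (ℚP.*-comm x (p * q)) (ℚP.*-assoc p q x)
    sum-over-c : ∀ b → sumCoinv h k (λ c → pat h c (n , z) * X b c) ≡ sumList (allSubsets n) (λ J₂ → X b (z ↾ J₂))
    sum-over-c b = sumCoinv-pat k z (X b) (X-respʳ b) (λ c → X-vanish b c ∘ ℕP.m≤n⇒m≤o+n (proj₁ b))

  Δ-eval : ∀ x y z → Δ h x y z ≡ eval h x (y ∙ z)
  Δ-eval x y z = sumList-cong x (λ { (q , a) → cong (q *_) (Δpat-pat a y z) })

  Additive : (Obj h → ℚ) → Set
  Additive f = ∀ y z → f (y ∙ z) ≡ f y + f z

  additive-cong : ∀ {f g : Obj h → ℚ} → (∀ u → f u ≡ g u) → Additive f → Additive g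
  additive-cong {f} {g} f≗g f-add y z = trans (sym (f≗g (y ∙ z))) (trans (f-add y z) (cong₂ _+_ (f≗g y) (f≗g z)))

  additive-+ : ∀ {f g : Obj h → ℚ} → Additive f → Additive g → Additive (λ u → f u + g u)
  additive-+ {f} {g} f-add g-add y z =
    trans (cong₂ _+_ (f-add y z) (g-add y z)) (+-interchange (f y) (f z) (g y) (g z))

  additive-*ˡ : ∀ q {f : Obj h → ℚ} → Additive f → Additive (λ u → q * f u)
  additive-*ˡ q {f} f-add y z = trans (cong (q *_) (f-add y z)) (ℚP.*-distribˡ-+ q (f y) (f z))

  additive-cancelˡ : ∀ {f g : Obj h → ℚ} → Additive f → Additive (λ u → f u + g u) → Additive g
  additive-cancelˡ {f} {g} f-add f+g-add y z = +-cancelˡ (f (y ∙ z)) (g (y ∙ z)) (g y + g z) (begin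
    f (y ∙ z) + g (y ∙ z)          ≡⟨ f+g-add y z ⟩
    (f y + g y) + (f z + g z)      ≡⟨ +-interchange (f y) (g y) (f z) (g z) ⟩
    (f y + f z) + (g y + g z)      ≡⟨ cong (_+ (g y + g z)) (f-add y z) ⟨
    f (y ∙ z) + (g y + g z)        ∎)
    where open ≡-Reasoning

  Decomposable : Obj h → Set
  Decomposable a = ∃₂ λ b c → (b ∙ c) ≈ a × ¬ b ≈ 𝟏 × ¬ c ≈ 𝟏

  Reducible : Obj h → Set
  Reducible a = a ≈ 𝟏 ⊎ Decomposable a

  any-H? : ∀ n {P : H n → Set} → (∀ x → Dec (P x)) → Dec (∃ P)
  any-H? n {P} P? = map′
    (λ (r , p) → elt h n r , p)
    (λ (x , p) → Inverse.to (enum n) x , subst P (sym (Inverse.strictlyInverseʳ (enum n) x)) p)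
    (FinP.any? (P? ∘ elt h n))

  any-Obj? : ∀ k {P : Obj h → Set} → (∀ u → Dec (P u)) → (∀ u → P u → proj₁ u < k) → Dec (∃ P)
  any-Obj? k {P} P? bounded = map′
    (λ (n , _ , x , p) → (n , x) , p)
    (λ ((n , x) , p) → n , bounded (n , x) p , x , p)
    (ℕP.anyUpTo? (λ n → any-H? n (λ x → P? (n , x))) k)

  decomposable? : ∀ a → Dec (Decomposable a)
  decomposable? a =
    any-Obj? (suc (proj₁ a)) (λ b →
      any-Obj? (suc (proj₁ a)) (λ c → ((b ∙ c) ≈? a) ×-dec (¬? (b ≈? 𝟏) ×-dec ¬? (c ≈? 𝟏)))
        (λ c (bc≈a , _) → s≤s (factor-size≤ʳ b c bc≈a)))
      (λ b (c , bc≈a , _) → s≤s (factor-size≤ˡ b c bc≈a))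
    where
    factor-size≤ˡ : ∀ b c → (b ∙ c) ≈ a → proj₁ b ≤ proj₁ a
    factor-size≤ˡ b c bc≈a = subst (proj₁ b ≤_) (≈-size bc≈a) (ℕP.m≤m+n (proj₁ b) (proj₁ c))
    factor-size≤ʳ : ∀ b c → (b ∙ c) ≈ a → proj₁ c ≤ proj₁ a
    factor-size≤ʳ b c bc≈a = subst (proj₁ c ≤_) (≈-size bc≈a) (ℕP.m≤n+m (proj₁ c) (proj₁ b))

  irreducible-or-reducible : ∀ a → Irreducible h a ⊎ Reducible a
  irreducible-or-reducible a with a ≈? 𝟏 | decomposable? a
  ... | yes a≈𝟏 | _                 = inj₂ (inj₁ a≈𝟏)
  ... | no _    | yes decomposable  = inj₂ (inj₂ decomposable)
  ... | no a≉𝟏  | no indecomposable = inj₁ (a≉𝟏 , trivial-factor)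
    where
    trivial-factor : ∀ b c → (b ∙ c) ≈ a → b ≈ 𝟏 ⊎ c ≈ 𝟏
    trivial-factor b c bc≈a with b ≈? 𝟏 | c ≈? 𝟏
    ... | yes b≈𝟏 | _       = inj₁ b≈𝟏
    ... | no _    | yes c≈𝟏 = inj₂ c≈𝟏
    ... | no b≉𝟏  | no c≉𝟏  = ⊥-elim (indecomposable (b , c , bc≈a , b≉𝟏 , c≉𝟏))

  -- Defs keeps the predicate "every term is irreducible" of InIrrSpan local to a where block;
  -- unifying against the type of InIrrSpan recovers it.
  IrreducibleTerms : Comb h → Comb h → Set
  IrreducibleTerms x w = Σ-base (id {A = Σ-fibre (id {A = InIrrSpan h x}) w})
    where
    Σ-fibre : {A : Set} {B : A → Set} → (Σ A B → Σ A B) → A → Set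
    Σ-fibre {B = B} _ = B
    Σ-base : {A : Set} {B : A → Set} → (Σ A B → Σ A B) → Set
    Σ-base {A = A} _ = A

  IrreducibleTerms⇒all : ∀ {x} w → IrreducibleTerms x w → All (Irreducible h ∘ proj₂) w
  IrreducibleTerms⇒all         []      _               = []
  IrreducibleTerms⇒all {x = x} (_ ∷ w) (a-irr , w-irr) = a-irr ∷ IrreducibleTerms⇒all {x = x} w w-irr

  all⇒IrreducibleTerms : ∀ {x} w → All (Irreducible h ∘ proj₂) w → IrreducibleTerms x w
  all⇒IrreducibleTerms         []      []              = _
  all⇒IrreducibleTerms {x = x} (_ ∷ w) (a-irr ∷ w-irr) = a-irr , all⇒IrreducibleTerms {x = x} w w-irr

  record ReducibilitySplit (x : Comb h) : Set where
    field
      irreducible-part reducible-part : Comb h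
      all-irreducible : All (Irreducible h ∘ proj₂) irreducible-part
      all-reducible   : All (Reducible ∘ proj₂) reducible-part
      eval-split      : ∀ u → eval h x u ≡ eval h irreducible-part u + eval h reducible-part u

  reducibility-split : ∀ x → ReducibilitySplit x
  reducibility-split [] = record
    { irreducible-part = [] ; reducible-part = []
    ; all-irreducible = [] ; all-reducible = []
    ; eval-split = λ _ → refl
    }
  reducibility-split ((q , a) ∷ x) = extend (irreducible-or-reducible a) (reducibility-split x)
    where
    extend : Irreducible h a ⊎ Reducible a → ReducibilitySplit x → ReducibilitySplit ((q , a) ∷ x)
    extend (inj₁ a-irr) split = record
      { irreducible-part = (q , a) ∷ w ; reducible-part = r
      ; all-irreducible = a-irr ∷ w-irr ; all-reducible = r-red
      ; eval-split = λ u → trans (cong (q * pat h a u +_) (eval-split u))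
                                 (sym (ℚP.+-assoc (q * pat h a u) (eval h w u) (eval h r u)))
      }
      where
      open ReducibilitySplit split
        renaming (irreducible-part to w; reducible-part to r; all-irreducible to w-irr; all-reducible to r-red)
    extend (inj₂ a-red) split = record
      { irreducible-part = w ; reducible-part = (q , a) ∷ r
      ; all-irreducible = w-irr ; all-reducible = a-red ∷ r-red
      ; eval-split = λ u → trans (cong (q * pat h a u +_) (eval-split u))
                                 (+-lcomm (q * pat h a u) (eval h w u) (eval h r u))
      }
      where
      open ReducibilitySplit split
        renaming (irreducible-part to w; reducible-part to r; all-irreducible to w-irr; all-reducible to r-red)

  coeff : Comb h → Obj h → ℚ
  coeff r s = sumList r (λ (q , a) → q * indicator (s ≈? a))

  eval-as-coeff : ∀ r {n} (t : H n) → eval h r (n , t) ≡ sumList (allSubsets n) (λ J → coeff r (t ↾ J))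
  eval-as-coeff r {n} t = trans
    (sumList-cong r (λ (q , a) → sym (sumList-*ˡ (allSubsets n) q (λ J → indicator ((t ↾ J) ≈? a)))))
    (sumList-comm r (allSubsets n) (λ (q , a) J → q * indicator ((t ↾ J) ≈? a)))

  coeff-resp : ∀ r → coeff r Preserves _≈_ ⟶ _≡_
  coeff-resp r {s} {s′} s≈s′ = sumList-cong r (λ (q , a) →
    cong (q *_) (indicator-cong (s ≈? a) (s′ ≈? a) (≈-trans (≈-sym s≈s′)) (≈-trans s≈s′)))

  coeff-support : ∀ {P : Obj h → Set} r → All (P ∘ proj₂) r → ∀ s → (∃ λ a → s ≈ a × P a) ⊎ coeff r s ≡ 0ℚ
  coeff-support []            []          s = inj₂ refl
  coeff-support ((q , a) ∷ r) (pa ∷ r-P) s with s ≈? a | coeff-support r r-P s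
  ... | yes s≈a | _              = inj₁ (a , s≈a , pa)
  ... | no _    | inj₁ found     = inj₁ found
  ... | no s≉a  | inj₂ coeff-r≡0 = inj₂ (begin
    q * indicator (s ≈? a) + coeff r s  ≡⟨ cong₂ _+_ (cong (q *_) (indicator-no (s ≈? a) s≉a)) coeff-r≡0 ⟩
    q * 0ℚ + 0ℚ                         ≡⟨ trans (ℚP.+-identityʳ (q * 0ℚ)) (ℚP.*-zeroʳ q) ⟩
    0ℚ                                  ∎)
    where open ≡-Reasoning

  CoeffVanishes : Comb h → ℕ → Set
  CoeffVanishes r n = ∀ (t : H n) → coeff r (n , t) ≡ 0ℚ

  eval-below : ∀ r n → (∀ {m} → m < n → CoeffVanishes r m) → ∀ u → proj₁ u < n → eval h r u ≡ 0ℚ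
  eval-below r n below (m , t) m<n =
    trans (eval-as-coeff r t) (sumList-zero (allSubsets m) (λ J → below (ℕP.≤-<-trans (cnt≤ J) m<n) (res (emb J) t)))

  eval-top : ∀ r n → (∀ {m} → m < n → CoeffVanishes r m) → ∀ u → proj₁ u ≡ n → eval h r u ≡ coeff r u
  eval-top r n below (n , t) refl = begin
    eval h r (n , t)
      ≡⟨ eval-as-coeff r t ⟩
    sumList (allSubsets n) (λ J → coeff r (t ↾ J))
      ≡⟨ sum-subsets-single n (full n) (λ J → coeff r (t ↾ J)) (λ J J≢full → below (cnt<-proper J J≢full) (res (emb J) t)) ⟩
    coeff r (t ↾ full n)
      ≡⟨ cong (coeff r) (↾-full t) ⟩
    coeff r (n , t) ∎
    where open ≡-Reasoning

  module _ (connected : Connected h) where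

    size≡0⇒≈𝟏 : ∀ u → proj₁ u ≡ 0 → u ≈ 𝟏
    size≡0⇒≈𝟏 (0 , x) refl = ≈-reflexive (cong (0 ,_) (connected x))

    ∙-identityˡ : ∀ u v → proj₁ u ≡ 0 → u ∙ v ≡ v
    ∙-identityˡ (0 , x) (n , y) refl = cong (n ,_) (trans (cong (_⋆ y) (connected x)) (unitˡ y))

    ∙-identityʳ : ∀ u v → proj₁ v ≡ 0 → u ∙ v ≡ u
    ∙-identityʳ (m , x) (0 , y) refl = begin
      (m ℕ.+ 0 , x ⋆ y)                               ≡⟨ cong (λ y → m ℕ.+ 0 , x ⋆ y) (connected y) ⟩
      (m ℕ.+ 0 , x ⋆ unit)                            ≡⟨ cong (m ℕ.+ 0 ,_) (unitʳ x) ⟩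
      (m ℕ.+ 0 , subst H (sym (ℕP.+-identityʳ m)) x)  ≡⟨ Σ-subst (sym (ℕP.+-identityʳ m)) x ⟩
      (m , x)                                         ∎
      where
      open ≡-Reasoning
      Σ-subst : ∀ {p q} (e : p ≡ q) (x : H p) → _≡_ {A = Obj h} (q , subst H e x) (p , x)
      Σ-subst refl x = refl

    pat-𝟏 : ∀ u → pat h 𝟏 u ≡ 1ℚ
    pat-𝟏 (n , t) = trans
      (sum-subsets-single n (empty n) (λ J → indicator ((t ↾ J) ≈? 𝟏))
        (λ J J≢∅ → indicator-no ((t ↾ J) ≈? 𝟏) (J≢∅ ∘ cnt≡0⇒empty J ∘ ≈-size)))
      (indicator-yes ((t ↾ empty n) ≈? 𝟏) (size≡0⇒≈𝟏 (t ↾ empty n) (cnt-empty n)))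

    additive-𝟏 : ∀ {f : Obj h → ℚ} → Additive f → f 𝟏 ≡ 0ℚ
    additive-𝟏 {f} f-add = sym (+-cancelˡ (f 𝟏) 0ℚ (f 𝟏) (begin
      f 𝟏 + 0ℚ      ≡⟨ ℚP.+-identityʳ (f 𝟏) ⟩
      f 𝟏           ≡⟨ cong f (∙-identityˡ 𝟏 𝟏 refl) ⟨
      f (𝟏 ∙ 𝟏)     ≡⟨ f-add 𝟏 𝟏 ⟩
      f 𝟏 + f 𝟏     ∎))
      where open ≡-Reasoning

    irreducible-∙-indicator : ∀ {a} → Irreducible h a → ∀ u v →
      indicator ((u ∙ v) ≈? a) ≡ indicator (u ≈? a) * indicator (v ≈? 𝟏) + indicator (u ≈? 𝟏) * indicator (v ≈? a)
    irreducible-∙-indicator {a} (a≉𝟏 , a-irr) u v = by-units (u ≈? 𝟏) (v ≈? 𝟏)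
      where
      ≉a : ∀ w → w ≈ 𝟏 → indicator (w ≈? a) ≡ 0ℚ
      ≉a w w≈𝟏 = indicator-no (w ≈? a) (λ w≈a → a≉𝟏 (≈-trans (≈-sym w≈a) w≈𝟏))
      by-units : (u? : Dec (u ≈ 𝟏)) (v? : Dec (v ≈ 𝟏)) →
        indicator ((u ∙ v) ≈? a) ≡ indicator (u ≈? a) * indicator v? + indicator u? * indicator (v ≈? a)
      by-units (yes u≈𝟏) (yes v≈𝟏) = begin
        indicator ((u ∙ v) ≈? a)
          ≡⟨ ≉a (u ∙ v) (size≡0⇒≈𝟏 (u ∙ v) (cong₂ ℕ._+_ (≈-size u≈𝟏) (≈-size v≈𝟏))) ⟩
        0ℚ * 1ℚ + 1ℚ * 0ℚ
          ≡⟨ cong₂ (λ s t → s * 1ℚ + 1ℚ * t) (≉a u u≈𝟏) (≉a v v≈𝟏) ⟨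
        indicator (u ≈? a) * 1ℚ + 1ℚ * indicator (v ≈? a) ∎
        where open ≡-Reasoning
      by-units (yes u≈𝟏) (no v≉𝟏) = begin
        indicator ((u ∙ v) ≈? a)
          ≡⟨ cong (λ w → indicator (w ≈? a)) (∙-identityˡ u v (≈-size u≈𝟏)) ⟩
        indicator (v ≈? a)
          ≡⟨ trans (ℚP.+-identityˡ _) (ℚP.*-identityˡ _) ⟨
        0ℚ + 1ℚ * indicator (v ≈? a)
          ≡⟨ cong (λ s → s * 0ℚ + 1ℚ * indicator (v ≈? a)) (≉a u u≈𝟏) ⟨
        indicator (u ≈? a) * 0ℚ + 1ℚ * indicator (v ≈? a) ∎
        where open ≡-Reasoning
      by-units (no u≉𝟏) (yes v≈𝟏) = begin
        indicator ((u ∙ v) ≈? a)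
          ≡⟨ cong (λ w → indicator (w ≈? a)) (∙-identityʳ u v (≈-size v≈𝟏)) ⟩
        indicator (u ≈? a)
          ≡⟨ trans (ℚP.+-identityʳ _) (ℚP.*-identityʳ _) ⟨
        indicator (u ≈? a) * 1ℚ + 0ℚ
          ≡⟨ cong (λ t → indicator (u ≈? a) * 1ℚ + 0ℚ * t) (≉a v v≈𝟏) ⟨
        indicator (u ≈? a) * 1ℚ + 0ℚ * indicator (v ≈? a) ∎
        where open ≡-Reasoning
      by-units (no u≉𝟏) (no v≉𝟏) = begin
        indicator ((u ∙ v) ≈? a)
          ≡⟨ indicator-no ((u ∙ v) ≈? a) (λ uv≈a → [ u≉𝟏 , v≉𝟏 ]′ (a-irr u v uv≈a)) ⟩
        0ℚ
          ≡⟨ cong₂ _+_ (ℚP.*-zeroʳ (indicator (u ≈? a))) (ℚP.*-zeroˡ (indicator (v ≈? a))) ⟨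
        indicator (u ≈? a) * 0ℚ + 0ℚ * indicator (v ≈? a) ∎
        where open ≡-Reasoning

    pat-additive : ∀ {a} → Irreducible h a → Additive (pat h a)
    pat-additive {a} a-irr (m , y) (n , z) = begin
      pat h a ((m , y) ∙ (n , z))
        ≡⟨ pat-∙ a y z ⟩
      sumList S₁ (λ J₁ → sumList S₂ (λ J₂ → indicator (((y ↾ J₁) ∙ (z ↾ J₂)) ≈? a)))
        ≡⟨ sumList-cong S₁ (λ J₁ → trans (sumList-cong S₂ (λ J₂ → irreducible-∙-indicator a-irr (y ↾ J₁) (z ↾ J₂)))
                                         (sumList-+ S₂ (λ J₂ → Ay J₁ * 𝟏z J₂) (λ J₂ → 𝟏y J₁ * Az J₂))) ⟩
      sumList S₁ (λ J₁ → sumList S₂ (λ J₂ → Ay J₁ * 𝟏z J₂) + sumList S₂ (λ J₂ → 𝟏y J₁ * Az J₂))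
        ≡⟨ sumList-+ S₁ (λ J₁ → sumList S₂ (λ J₂ → Ay J₁ * 𝟏z J₂)) (λ J₁ → sumList S₂ (λ J₂ → 𝟏y J₁ * Az J₂)) ⟩
      sumList S₁ (λ J₁ → sumList S₂ (λ J₂ → Ay J₁ * 𝟏z J₂)) + sumList S₁ (λ J₁ → sumList S₂ (λ J₂ → 𝟏y J₁ * Az J₂))
        ≡⟨ cong₂ _+_ (sumList-*-sumList S₁ S₂ Ay 𝟏z) (sumList-*-sumList S₁ S₂ 𝟏y Az) ⟨
      pat h a (m , y) * pat h 𝟏 (n , z) + pat h 𝟏 (m , y) * pat h a (n , z)
        ≡⟨ cong₂ (λ s t → pat h a (m , y) * s + t * pat h a (n , z)) (pat-𝟏 (n , z)) (pat-𝟏 (m , y)) ⟩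
      pat h a (m , y) * 1ℚ + 1ℚ * pat h a (n , z)
        ≡⟨ cong₂ _+_ (ℚP.*-identityʳ (pat h a (m , y))) (ℚP.*-identityˡ (pat h a (n , z))) ⟩
      pat h a (m , y) + pat h a (n , z) ∎
      where
      open ≡-Reasoning
      S₁ = allSubsets m
      S₂ = allSubsets n
      Ay 𝟏y : Vec Bool m → ℚ
      Ay J₁ = indicator ((y ↾ J₁) ≈? a)
      𝟏y J₁ = indicator ((y ↾ J₁) ≈? 𝟏)
      Az 𝟏z : Vec Bool n → ℚ
      Az J₂ = indicator ((z ↾ J₂) ≈? a)
      𝟏z J₂ = indicator ((z ↾ J₂) ≈? 𝟏)

    primitive⇔additive : ∀ x → Primitive h x ⇔ Additive (eval h x)
    primitive⇔additive x = mk⇔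
      (λ x-prim y z → trans (sym (Δ-eval x y z)) (trans (x-prim y z) (unit-terms y z)))
      (λ x-add y z → trans (Δ-eval x y z) (trans (x-add y z) (sym (unit-terms y z))))
      where
      unit-terms : ∀ y z → eval h x y * pat h 𝟏 z + pat h 𝟏 y * eval h x z ≡ eval h x y + eval h x z
      unit-terms y z = begin
        eval h x y * pat h 𝟏 z + pat h 𝟏 y * eval h x z
          ≡⟨ cong₂ (λ s t → eval h x y * s + t * eval h x z) (pat-𝟏 z) (pat-𝟏 y) ⟩
        eval h x y * 1ℚ + 1ℚ * eval h x z
          ≡⟨ cong₂ _+_ (ℚP.*-identityʳ (eval h x y)) (ℚP.*-identityˡ (eval h x z)) ⟩
        eval h x y + eval h x z ∎
        where open ≡-Reasoning

    eval-additive : ∀ w → All (Irreducible h ∘ proj₂) w → Additive (eval h w)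
    eval-additive []            []                   y z = refl
    eval-additive ((q , a) ∷ w) (a-irr ∷ w-irr) =
      additive-+ {λ u → q * pat h a u} {eval h w} (additive-*ˡ q (pat-additive a-irr)) (eval-additive w w-irr)

    nontrivial-factors-smaller : ∀ {a b c} → (b ∙ c) ≈ a → ¬ b ≈ 𝟏 → ¬ c ≈ 𝟏 → proj₁ b < proj₁ a × proj₁ c < proj₁ a
    nontrivial-factors-smaller {a} {b} {c} bc≈a b≉𝟏 c≉𝟏 =
      subst (proj₁ b <_) (≈-size bc≈a) (ℕP.m<m+n (proj₁ b) (ℕP.n≢0⇒n>0 (c≉𝟏 ∘ size≡0⇒≈𝟏 c))) ,
      subst (proj₁ c <_) (≈-size bc≈a) (ℕP.m<n+m (proj₁ c) (ℕP.n≢0⇒n>0 (b≉𝟏 ∘ size≡0⇒≈𝟏 b)))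

    reducible-additive-vanishes : ∀ r → All (Reducible ∘ proj₂) r → Additive (eval h r) → ∀ u → eval h r u ≡ 0ℚ
    reducible-additive-vanishes r r-red r-add u =
      eval-below r (suc (proj₁ u)) (λ {m} _ → <-rec (CoeffVanishes r) step m) u ℕP.≤-refl
      where
      step : ∀ n → (∀ {m} → m < n → CoeffVanishes r m) → CoeffVanishes r n
      step n below t = from-support (coeff-support r r-red (n , t))
        where
        via : ∀ u → (n , t) ≈ u → eval h r u ≡ 0ℚ → coeff r (n , t) ≡ 0ℚ
        via u s≈u eval≡0 = trans (coeff-resp r s≈u) (trans (sym (eval-top r n below u (sym (≈-size s≈u)))) eval≡0)
        from-support : (∃ λ a → (n , t) ≈ a × Reducible a) ⊎ coeff r (n , t) ≡ 0ℚ → coeff r (n , t) ≡ 0ℚ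
        from-support (inj₂ coeff≡0)              = coeff≡0
        from-support (inj₁ (a , s≈a , inj₁ a≈𝟏)) = via 𝟏 (≈-trans s≈a a≈𝟏) (additive-𝟏 {eval h r} r-add)
        from-support (inj₁ (a , s≈a , inj₂ (b , c , bc≈a , b≉𝟏 , c≉𝟏))) = via (b ∙ c) s≈bc (begin
          eval h r (b ∙ c)          ≡⟨ r-add b c ⟩
          eval h r b + eval h r c   ≡⟨ cong₂ _+_ (eval-below r n below b b<n) (eval-below r n below c c<n) ⟩
          0ℚ                        ∎)
          where
          open ≡-Reasoning
          s≈bc : (n , t) ≈ (b ∙ c)
          s≈bc = ≈-trans s≈a (≈-sym bc≈a)
          b<n : proj₁ b < n
          b<n = proj₁ (nontrivial-factors-smaller (≈-sym s≈bc) b≉𝟏 c≉𝟏)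
          c<n : proj₁ c < n
          c<n = proj₂ (nontrivial-factors-smaller (≈-sym s≈bc) b≉𝟏 c≉𝟏)

    additive⇒InIrrSpan : ∀ x → Additive (eval h x) → InIrrSpan h x
    additive⇒InIrrSpan x x-add = w , all⇒IrreducibleTerms {x = x} w w-irr , λ u → begin
      eval h w u                 ≡⟨ ℚP.+-identityʳ (eval h w u) ⟨
      eval h w u + 0ℚ            ≡⟨ cong (eval h w u +_) (reducible-additive-vanishes r r-red r-add u) ⟨
      eval h w u + eval h r u    ≡⟨ eval-split u ⟨
      eval h x u                 ∎
      where
      open ≡-Reasoning
      open ReducibilitySplit (reducibility-split x)
        renaming (irreducible-part to w; reducible-part to r; all-irreducible to w-irr; all-reducible to r-red)
      r-add : Additive (eval h r)
      r-add = additive-cancelˡ {eval h w} (eval-additive w w-irr) (additive-cong eval-split x-add)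

    InIrrSpan⇒additive : ∀ x → InIrrSpan h x → Additive (eval h x)
    InIrrSpan⇒additive x (w , w-irr , w≗x) =
      additive-cong w≗x (eval-additive w (IrreducibleTerms⇒all {x = x} w w-irr))

mainTheorem4 : (h : AssocPresheaf) → Connected h →
    (x : Comb h) → Primitive h x ⇔ InIrrSpan h x
mainTheorem4 h connected x =
  mk⇔ (additive⇒InIrrSpan h connected x) (InIrrSpan⇒additive h connected x) ⇔-∘ primitive⇔additive h connected x
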